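{- The class $\mathcal{C}\cap\mathcal{W}$ of trivial cofibrations in $\mathbf{rPres}$ equals the class of morphisms having the left lifting property with respect to every morphism that has the right lifting property with respect to all morphisms of $\mathcal{C}\cap\mathcal{W}$.
   Context: $\mathbf{rPres}$ is the category of reflexive presentations of monoids (generators $P_1$, relations $P_2\subseteq P_1^*\times P_1^*$ containing $u\to u$ for every word; morphisms are maps on generators sending relations to relations); it is cocomplete and locally finitely presentable. $\mathcal{W}$ is the class of morphisms inducing an isomorphism between presented monoids ($P_1^*$ quotiented by the congruence generated by $P_2$). With $G$ the presentation with one generator and no relation, $G^n$ the one with $n$ generators and no relation, and $R^{m,n}$ the one with generators $a_1,\dots,a_{m+n}$ and relation $a_1\cdots a_m\to a_{m+1}\cdots a_{m+n}$, $\mathcal{I}$ is the class of inclusions $\emptyset\to G$ and $G^{m+n}\to R^{m,n}$, and $\mathcal{C}$ is the class of morphisms having the left lifting property with respect to every morphism that has the right lifting property with respect to all of $\mathcal{I}$. -}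

module Defs where

open import Level using (Level; 0ℓ) renaming (suc to lsuc)
open import Data.Nat using (ℕ; _+_)
open import Data.Fin using (Fin; _↑ˡ_; _↑ʳ_)
open import Data.List using (List; map; _++_; allFin)
open import Data.Empty using (⊥)
open import Data.Unit using (⊤)
open import Data.Sum using (_⊎_; inj₁; inj₂)
open import Data.Product using (_×_; _,_; Σ; ∃)
open import Relation.Binary.PropositionalEquality using (_≡_; refl)

-- A reflexive presentation of a monoid: generators P₁, relations P₂ on
-- words P₁*, containing u → u for every word u.
record Pres : Set₁ where
  field
    Gen   : Set
    Rel   : List Gen → List Gen → Set
    rrefl : ∀ u → Rel u u
open Pres public

record Hom (P Q : Pres) : Set where
  field
    fun  : Gen P → Gen Q
    rel  : ∀ {u v} → Rel P u v → Rel Q (map fun u) (map fun v)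
open Hom public

-- Left lifting property of f w.r.t. g (equality of morphisms = equality of
-- their generator maps, pointwise).
LLP : ∀ {A B X Y} → Hom A B → Hom X Y → Set
LLP {A} {B} {X} {Y} f g =
  (u : Hom A X) (v : Hom B Y) →
  (∀ a → fun g (fun u a) ≡ fun v (fun f a)) →
  Σ (Hom B X) λ h → (∀ a → fun h (fun f a) ≡ fun u a) × (∀ b → fun g (fun h b) ≡ fun v b)

Class : Set₂
Class = ∀ {A B} → Hom A B → Set₁

rlp : Class → Class
rlp K g = ∀ {A B} (f : Hom A B) → K f → LLP f g

llp : Class → Class
llp K f = ∀ {X Y} (g : Hom X Y) → K g → LLP f g

_∩_ : Class → Class → Class
(K ∩ L) f = K f × L f

data Cong (P : Pres) : List (Gen P) → List (Gen P) → Set where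
  c-rel   : ∀ {u v} → Rel P u v → Cong P u v
  c-refl  : ∀ {u} → Cong P u u
  c-sym   : ∀ {u v} → Cong P u v → Cong P v u
  c-trans : ∀ {u v w} → Cong P u v → Cong P v w → Cong P u w
  c-ctx   : ∀ w₁ w₂ {u v} → Cong P u v → Cong P (w₁ ++ u ++ w₂) (w₁ ++ v ++ w₂)

-- f ∈ W : the induced monoid morphism P₁*/≈ → Q₁*/≈, [u] ↦ [f* u], is bijective
-- (hence an isomorphism of presented monoids).
IsWeq : ∀ {P Q} → Hom P Q → Set
IsWeq {P} {Q} f =
  (∀ u v → Cong Q (map (fun f) u) (map (fun f) v) → Cong P u v) ×
  (∀ w → ∃ λ u → Cong Q (map (fun f) u) w)

W : Class
W f = Level.Lift (lsuc 0ℓ) (IsWeq f)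

freePres : Set → Pres
freePres X = record { Gen = X ; Rel = _≡_ ; rrefl = λ u → refl }

Empty G : Pres
Empty = freePres ⊥
G = freePres ⊤

Gⁿ : ℕ → Pres
Gⁿ n = freePres (Fin n)

-- R^{m,n}: generators a₁..a_{m+n}, relation a₁⋯a_m → a_{m+1}⋯a_{m+n}
lhsW : ∀ m n → List (Fin (m + n))
lhsW m n = map (_↑ˡ n) (allFin m)

rhsW : ∀ m n → List (Fin (m + n))
rhsW m n = map (m ↑ʳ_) (allFin n)

R : ℕ → ℕ → Pres
R m n = record
  { Gen = Fin (m + n)
  ; Rel = λ u v → (u ≡ v) ⊎ ((u ≡ lhsW m n) × (v ≡ rhsW m n))
  ; rrefl = λ u → inj₁ refl }

empty→G : Hom Empty G
empty→G = record { fun = λ () ; rel = λ e → cong (map λ ()) e }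
  where open import Relation.Binary.PropositionalEquality using (cong)

G→R : ∀ m n → Hom (Gⁿ (m + n)) (R m n)
G→R m n = record { fun = λ x → x ; rel = λ {u} {v} e → inj₁ (helper e) }
  where
    open import Data.List.Properties using (map-id)
    open import Relation.Binary.PropositionalEquality using (cong)
    helper : ∀ {u v : List (Fin (m + n))} → u ≡ v → map (λ x → x) u ≡ map (λ x → x) v
    helper e = cong (map (λ x → x)) e

data 𝓘 : ∀ {A B} → Hom A B → Set₁ where
  i-empty : 𝓘 empty→G
  i-rel   : ∀ m n → 𝓘 (G→R m n)

𝓒 : Class
𝓒 = llp (rlp 𝓘)

{-# OPTIONS --safe #-}
module Submission where

-- That llp (rlp (𝓒 ∩ W)) lies in 𝓒 is formal, since rlp 𝓘 ⊆ rlp 𝓒.  For W, lift f : A → B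
-- against the projection Lifts → B, where a generator of Lifts is a word of A together
-- with a generator of B it presents, and B carries its whole congruence as relations.
-- This projection lifts against every trivial cofibration j : A′ → B′: surjectivity of j
-- gives each generator of B′ a preimage word and hence a lift, lifting j against the
-- trivial fibration of such choices makes them compatible with j, and injectivity of j
-- makes them respect relations.  The lift B → Lifts of f then splits [u] ↦ [f u].

open import Defs
import Level
open import Function using (_∘_; id)
open import Data.Product using (_×_; _,_; Σ; proj₁; proj₂)
open import Data.Sum using (inj₁; inj₂)
open import Data.List using (List; []; _∷_; [_]; map; _++_; concatMap)
open import Data.List.Properties
  using (map-∘; map-id; map-cong; map-++; ++-identityʳ; concatMap-++; concatMap-map; concatMap-pure; map-concatMap)
open import Relation.Binary.Bundles using (Setoid)
open import Relation.Binary.PropositionalEquality using (_≡_; refl; sym; trans; cong; subst; subst₂; module ≡-Reasoning)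
import Relation.Binary.Reasoning.Setoid as SetoidReasoning

_⊆_ : Class → Class → Set₁
K ⊆ L = ∀ {A B} (f : Hom A B) → K f → L f

rlp-antitone : ∀ {K L : Class} → K ⊆ L → rlp L ⊆ rlp K
rlp-antitone K⊆L g g∈rlpL f f∈K = g∈rlpL f (K⊆L f f∈K)

llp-antitone : ∀ {K L : Class} → K ⊆ L → llp L ⊆ llp K
llp-antitone K⊆L f f∈llpL g g∈K = f∈llpL g (K⊆L g g∈K)

⊆-rlp-llp : ∀ {K : Class} → K ⊆ rlp (llp K)
⊆-rlp-llp g g∈K f f∈llpK = f∈llpK g g∈K

⊆-llp-rlp : ∀ {K : Class} → K ⊆ llp (rlp K)
⊆-llp-rlp f f∈K g g∈rlpK = g∈rlpK f f∈K

∩-⊆ˡ : ∀ {K L : Class} → (K ∩ L) ⊆ K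
∩-⊆ˡ f = proj₁

rlp𝓘⊆rlp-𝓒∩W : rlp 𝓘 ⊆ rlp (𝓒 ∩ W)
rlp𝓘⊆rlp-𝓒∩W g g∈rlp𝓘 = rlp-antitone (∩-⊆ˡ {𝓒} {W}) g (⊆-rlp-llp {rlp 𝓘} g g∈rlp𝓘)

llp-rlp-𝓒∩W⊆𝓒 : llp (rlp (𝓒 ∩ W)) ⊆ 𝓒
llp-rlp-𝓒∩W⊆𝓒 = llp-antitone rlp𝓘⊆rlp-𝓒∩W

concatMap-concatMap : ∀ {X Y Z : Set} (g : Y → List Z) (h : X → List Y) xs →
  concatMap g (concatMap h xs) ≡ concatMap (concatMap g ∘ h) xs
concatMap-concatMap g h [] = refl
concatMap-concatMap g h (x ∷ xs) =
  trans (concatMap-++ g (h x) (concatMap h xs)) (cong (concatMap g (h x) ++_) (concatMap-concatMap g h xs))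

map-as-concatMap : ∀ {X Y : Set} (f : X → Y) xs → concatMap ([_] ∘ f) xs ≡ map f xs
map-as-concatMap f xs = trans (sym (concatMap-map [_] f xs)) (concatMap-pure (map f xs))

Cong-setoid : Pres → Setoid Level.zero Level.zero
Cong-setoid P = record
  { Carrier = List (Gen P)
  ; _≈_ = Cong P
  ; isEquivalence = record { refl = c-refl ; sym = c-sym ; trans = c-trans }
  }

module CongReasoning (P : Pres) = SetoidReasoning (Cong-setoid P)

≡⇒Cong : ∀ {P u v} → u ≡ v → Cong P u v
≡⇒Cong refl = c-refl

Cong-++ : ∀ {P u u′ v v′} → Cong P u u′ → Cong P v v′ → Cong P (u ++ v) (u′ ++ v′)
Cong-++ {P} {u′ = u′} {v} {v′} u≈u′ v≈v′ =
  c-trans (c-ctx [] v u≈u′)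
    (subst₂ (Cong P) (cong (u′ ++_) (++-identityʳ v)) (cong (u′ ++_) (++-identityʳ v′)) (c-ctx u′ [] v≈v′))

Cong-concatMap-pointwise : ∀ {P} {X : Set} {φ ψ : X → List (Gen P)} →
  (∀ x → Cong P (φ x) (ψ x)) → ∀ xs → Cong P (concatMap φ xs) (concatMap ψ xs)
Cong-concatMap-pointwise φ≈ψ []       = c-refl
Cong-concatMap-pointwise φ≈ψ (x ∷ xs) = Cong-++ (φ≈ψ x) (Cong-concatMap-pointwise φ≈ψ xs)

++-homomorphism-preserves-Cong : ∀ {P Q} (φ : List (Gen P) → List (Gen Q)) →
  (∀ u v → φ (u ++ v) ≡ φ u ++ φ v) →
  (∀ {u v} → Rel P u v → Cong Q (φ u) (φ v)) →
  ∀ {u v} → Cong P u v → Cong Q (φ u) (φ v)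
++-homomorphism-preserves-Cong φ φ-++ φ-rel (c-rel r)       = φ-rel r
++-homomorphism-preserves-Cong φ φ-++ φ-rel c-refl          = c-refl
++-homomorphism-preserves-Cong φ φ-++ φ-rel (c-sym c)       =
  c-sym (++-homomorphism-preserves-Cong φ φ-++ φ-rel c)
++-homomorphism-preserves-Cong φ φ-++ φ-rel (c-trans c d)   =
  c-trans (++-homomorphism-preserves-Cong φ φ-++ φ-rel c) (++-homomorphism-preserves-Cong φ φ-++ φ-rel d)
++-homomorphism-preserves-Cong {Q = Q} φ φ-++ φ-rel (c-ctx w₁ w₂ {u} {v} c) =
  subst₂ (Cong Q) (sym (φ-ctx u)) (sym (φ-ctx v))
    (c-ctx (φ w₁) (φ w₂) (++-homomorphism-preserves-Cong φ φ-++ φ-rel c))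
  where
    φ-ctx : ∀ t → φ (w₁ ++ t ++ w₂) ≡ φ w₁ ++ φ t ++ φ w₂
    φ-ctx t = trans (φ-++ w₁ (t ++ w₂)) (cong (φ w₁ ++_) (φ-++ t w₂))

concatMap-preserves-Cong : ∀ {P Q} (ψ : Gen P → List (Gen Q)) →
  (∀ {u v} → Rel P u v → Cong Q (concatMap ψ u) (concatMap ψ v)) →
  ∀ {u v} → Cong P u v → Cong Q (concatMap ψ u) (concatMap ψ v)
concatMap-preserves-Cong ψ = ++-homomorphism-preserves-Cong (concatMap ψ) (concatMap-++ ψ)

map-preserves-Cong : ∀ {P Q} (f : Gen P → Gen Q) →
  (∀ {u v} → Rel P u v → Cong Q (map f u) (map f v)) →
  ∀ {u v} → Cong P u v → Cong Q (map f u) (map f v)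
map-preserves-Cong f = ++-homomorphism-preserves-Cong (map f) (map-++ f)

Hom-preserves-Cong : ∀ {P Q} (h : Hom P Q) → ∀ {u v} → Cong P u v → Cong Q (map (fun h) u) (map (fun h) v)
Hom-preserves-Cong h = map-preserves-Cong (fun h) (c-rel ∘ rel h)

Hom-id : (P : Pres) → Hom P P
Hom-id P = record { fun = id ; rel = λ {u} {v} → subst₂ (Rel P) (sym (map-id u)) (sym (map-id v)) }

saturate : Pres → Pres
saturate P = record { Gen = Gen P ; Rel = Cong P ; rrefl = λ _ → c-refl }

toSaturate : (P : Pres) → Hom P (saturate P)
toSaturate P = record { fun = id ; rel = λ {u} {v} r → subst₂ (Cong P) (sym (map-id u)) (sym (map-id v)) (c-rel r) }

section-reflecting⇒rlp𝓘 : ∀ {E Y} (q : Hom E Y) (s : Gen Y → Gen E) →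
  (∀ y → fun q (s y) ≡ y) →
  (∀ u v → Rel Y (map (fun q) u) (map (fun q) v) → Rel E u v) →
  rlp 𝓘 q
section-reflecting⇒rlp𝓘 {E} q s q∘s≡id q-reflects .empty→G i-empty x y square =
  record { fun = λ _ → s (fun y _) ; rel = λ { refl → rrefl E _ } } , (λ ()) , (λ b → q∘s≡id (fun y b))
section-reflecting⇒rlp𝓘 {E} {Y} q s q∘s≡id q-reflects .(G→R m n) (i-rel m n) x y square =
  record { fun = fun x ; rel = x-rel } , (λ _ → refl) , square
  where
    q∘x-word : ∀ w → map (fun q) (map (fun x) w) ≡ map (fun y) w
    q∘x-word w = trans (sym (map-∘ w)) (map-cong square w)

    x-rel : ∀ {u v} → Rel (R m n) u v → Rel E (map (fun x) u) (map (fun x) v)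
    x-rel (inj₁ refl)          = rrefl E _
    x-rel (inj₂ (refl , refl)) = q-reflects _ _
      (subst₂ (Rel Y) (sym (q∘x-word (lhsW m n))) (sym (q∘x-word (rhsW m n))) (rel y (inj₂ (refl , refl))))

module WordLifts {A B : Pres} (f : Hom A B) where

  record Lift : Set where
    field
      word        : List (Gen A)
      letter      : Gen B
      word↦letter : Cong B (map (fun f) word) [ letter ]
  open Lift public

  flatten : List Lift → List (Gen A)
  flatten = concatMap word

  Lifts : Pres
  Lifts = record { Gen = Lift ; Rel = λ p q → Cong A (flatten p) (flatten q) ; rrefl = λ _ → c-refl }

  Lifts-Cong⇒Cong : ∀ {p q} → Cong Lifts p q → Cong A (flatten p) (flatten q)
  Lifts-Cong⇒Cong = concatMap-preserves-Cong word id

  map-flatten : ∀ p → Cong B (map (fun f) (flatten p)) (map letter p)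
  map-flatten p = begin
    map (fun f) (concatMap word p)    ≡⟨ map-concatMap (fun f) word p ⟩
    concatMap (map (fun f) ∘ word) p  ≈⟨ Cong-concatMap-pointwise word↦letter p ⟩
    concatMap ([_] ∘ letter) p        ≡⟨ map-as-concatMap letter p ⟩
    map letter p                      ∎
    where open CongReasoning B

  letterHom : Hom Lifts (saturate B)
  letterHom = record { fun = letter ; rel = λ {p} {q} r → begin
    map letter p                 ≈⟨ map-flatten p ⟨
    map (fun f) (flatten p)      ≈⟨ Hom-preserves-Cong f r ⟩
    map (fun f) (flatten q)      ≈⟨ map-flatten q ⟩
    map letter q                 ∎ }
    where open CongReasoning B

  singletonLift : Gen A → Lift
  singletonLift a = record { word = [ a ] ; letter = fun f a ; word↦letter = c-refl }

  flatten-map-singletonLift : ∀ u → flatten (map singletonLift u) ≡ u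
  flatten-map-singletonLift u = trans (concatMap-map word singletonLift u) (concatMap-pure u)

  unit : Hom A Lifts
  unit = record
    { fun = singletonLift
    ; rel = λ {u} {v} r →
        subst₂ (Cong A) (sym (flatten-map-singletonLift u)) (sym (flatten-map-singletonLift v)) (c-rel r) }

  section⇒IsWeq :
    Σ (Hom B Lifts) (λ h → (∀ a → fun h (fun f a) ≡ fun unit a) × (∀ b → letter (fun h b) ≡ b)) →
    IsWeq f
  section⇒IsWeq (h , h∘f≡unit , letter∘h≡id) = injective , surjective
    where
      retract : ∀ u → flatten (map (fun h) (map (fun f) u)) ≡ u
      retract u = begin
        flatten (map (fun h) (map (fun f) u))  ≡⟨ cong flatten (map-∘ u) ⟨
        flatten (map (fun h ∘ fun f) u)        ≡⟨ cong flatten (map-cong h∘f≡unit u) ⟩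
        flatten (map singletonLift u)          ≡⟨ flatten-map-singletonLift u ⟩
        u                                      ∎
        where open ≡-Reasoning

      injective : ∀ u v → Cong B (map (fun f) u) (map (fun f) v) → Cong A u v
      injective u v fu≈fv = subst₂ (Cong A) (retract u) (retract v) (Lifts-Cong⇒Cong (Hom-preserves-Cong h fu≈fv))

      surjective : ∀ w → Σ (List (Gen A)) λ u → Cong B (map (fun f) u) w
      surjective w = flatten (map (fun h) w) , (begin
        map (fun f) (flatten (map (fun h) w))  ≈⟨ map-flatten (map (fun h) w) ⟩
        map letter (map (fun h) w)             ≡⟨ map-∘ w ⟨
        map (letter ∘ fun h) w                 ≡⟨ map-cong letter∘h≡id w ⟩
        map id w                               ≡⟨ map-id w ⟩
        w                                      ∎)
        where open CongReasoning B

  module LiftAgainst {A′ B′ : Pres} (j : Hom A′ B′) (j∈W : IsWeq j)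
    (x : Hom A′ Lifts) (y : Hom B′ (saturate B)) (square : ∀ a → letter (fun x a) ≡ fun y (fun j a)) where

    j-injective : ∀ u v → Cong B′ (map (fun j) u) (map (fun j) v) → Cong A′ u v
    j-injective = proj₁ j∈W

    j-surjective : ∀ w → Σ (List (Gen A′)) λ u → Cong B′ (map (fun j) u) w
    j-surjective = proj₂ j∈W

    -- The preimage is carried so that lifts of related words compare through j-injective.
    record Candidate : Set where
      field
        base          : Gen B′
        lift          : Lift
        over          : letter lift ≡ fun y base
        preimage      : List (Gen A′)
        preimage↦base : Cong B′ (map (fun j) preimage) [ base ]
        preimage≈lift : Cong A (flatten (map (fun x) preimage)) (word lift)
    open Candidate

    Candidates : Pres
    Candidates = record
      { Gen = Candidate ; Rel = λ c d → Rel B′ (map base c) (map base d) ; rrefl = λ _ → rrefl B′ _ }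

    baseHom : Hom Candidates B′
    baseHom = record { fun = base ; rel = id }

    lift-of-preimage : ∀ b z → Cong B′ (map (fun j) z) [ b ] → Cong B (map (fun f) (flatten (map (fun x) z))) [ fun y b ]
    lift-of-preimage b z jz≈b = begin
      map (fun f) (flatten (map (fun x) z))  ≈⟨ map-flatten (map (fun x) z) ⟩
      map letter (map (fun x) z)             ≡⟨ map-∘ z ⟨
      map (letter ∘ fun x) z                 ≡⟨ map-cong square z ⟩
      map (fun y ∘ fun j) z                  ≡⟨ map-∘ z ⟩
      map (fun y) (map (fun j) z)            ≈⟨ map-preserves-Cong (fun y) (rel y) jz≈b ⟩
      [ fun y b ]                            ∎
      where open CongReasoning B

    candidateOver : Gen B′ → Candidate
    candidateOver b = record
      { base = b
      ; lift = record { word = flatten (map (fun x) z) ; letter = fun y b ; word↦letter = lift-of-preimage b z jz≈b }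
      ; over = refl
      ; preimage = z
      ; preimage↦base = jz≈b
      ; preimage≈lift = c-refl
      }
      where
        z : List (Gen A′)
        z = proj₁ (j-surjective [ b ])

        jz≈b : Cong B′ (map (fun j) z) [ b ]
        jz≈b = proj₂ (j-surjective [ b ])

    baseHom∈rlp𝓘 : rlp 𝓘 baseHom
    baseHom∈rlp𝓘 = section-reflecting⇒rlp𝓘 baseHom candidateOver (λ _ → refl) (λ _ _ r → r)

    candidateAt : Gen A′ → Candidate
    candidateAt a = record
      { base = fun j a ; lift = fun x a ; over = square a
      ; preimage = [ a ] ; preimage↦base = c-refl ; preimage≈lift = ≡⇒Cong (++-identityʳ _) }

    candidateAtHom : Hom A′ Candidates
    candidateAtHom = record
      { fun = candidateAt
      ; rel = λ {u} {v} r → subst₂ (Rel B′) (map-∘ u) (map-∘ v) (rel j r) }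

    module _ (k : Gen B′ → Candidate) (base∘k≡id : ∀ b → base (k b) ≡ b) where

      preimages : List (Gen B′) → List (Gen A′)
      preimages = concatMap (preimage ∘ k)

      preimages↦ : ∀ bs → Cong B′ (map (fun j) (preimages bs)) bs
      preimages↦ bs = begin
        map (fun j) (concatMap (preimage ∘ k) bs)  ≡⟨ map-concatMap (fun j) (preimage ∘ k) bs ⟩
        concatMap (map (fun j) ∘ preimage ∘ k) bs  ≈⟨ Cong-concatMap-pointwise preimage↦b bs ⟩
        concatMap [_] bs                           ≡⟨ concatMap-pure bs ⟩
        bs                                         ∎
        where
          open CongReasoning B′
          preimage↦b : ∀ b → Cong B′ (map (fun j) (preimage (k b))) [ b ]
          preimage↦b b = subst (λ c → Cong B′ (map (fun j) (preimage (k b))) [ c ]) (base∘k≡id b) (preimage↦base (k b))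

      preimages≈lifts : ∀ bs → Cong A (flatten (map (fun x) (preimages bs))) (flatten (map (lift ∘ k) bs))
      preimages≈lifts bs = begin
        flatten (map (fun x) (concatMap (preimage ∘ k) bs))        ≡⟨ cong flatten (map-concatMap (fun x) (preimage ∘ k) bs) ⟩
        flatten (concatMap (map (fun x) ∘ preimage ∘ k) bs)        ≡⟨ concatMap-concatMap word (map (fun x) ∘ preimage ∘ k) bs ⟩
        concatMap (flatten ∘ map (fun x) ∘ preimage ∘ k) bs        ≈⟨ Cong-concatMap-pointwise (preimage≈lift ∘ k) bs ⟩
        concatMap (word ∘ lift ∘ k) bs                             ≡⟨ concatMap-map word (lift ∘ k) bs ⟨
        flatten (map (lift ∘ k) bs)                                ∎
        where open CongReasoning A

      choice⇒Hom : Hom B′ Lifts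
      choice⇒Hom = record { fun = lift ∘ k ; rel = λ {bs} {cs} r → begin
        flatten (map (lift ∘ k) bs)          ≈⟨ preimages≈lifts bs ⟨
        flatten (map (fun x) (preimages bs)) ≈⟨ Lifts-Cong⇒Cong (Hom-preserves-Cong x (preimages-congruent r)) ⟩
        flatten (map (fun x) (preimages cs)) ≈⟨ preimages≈lifts cs ⟩
        flatten (map (lift ∘ k) cs)          ∎ }
        where
          open CongReasoning A
          preimages-congruent : ∀ {bs cs} → Rel B′ bs cs → Cong A′ (preimages bs) (preimages cs)
          preimages-congruent {bs} {cs} r = j-injective _ _
            (c-trans (preimages↦ bs) (c-trans (c-rel r) (c-sym (preimages↦ cs))))

    lift-from-candidates :
      Σ (Hom B′ Candidates) (λ k → (∀ a → fun k (fun j a) ≡ candidateAt a) × (∀ b → base (fun k b) ≡ b)) →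
      Σ (Hom B′ Lifts) (λ h → (∀ a → fun h (fun j a) ≡ fun x a) × (∀ b → letter (fun h b) ≡ fun y b))
    lift-from-candidates (k , k∘j≡candidateAt , base∘k≡id) =
      choice⇒Hom (fun k) base∘k≡id ,
      (λ a → cong lift (k∘j≡candidateAt a)) ,
      (λ b → trans (over (fun k b)) (cong (fun y) (base∘k≡id b)))

  letterHom∈rlp-𝓒∩W : rlp (𝓒 ∩ W) letterHom
  letterHom∈rlp-𝓒∩W j (j∈𝓒 , Level.lift j∈W) x y square =
    lift-from-candidates (j∈𝓒 baseHom baseHom∈rlp𝓘 candidateAtHom (Hom-id _) (λ _ → refl))
    where open LiftAgainst j j∈W x y square

llp-rlp-𝓒∩W⊆W : llp (rlp (𝓒 ∩ W)) ⊆ W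
llp-rlp-𝓒∩W⊆W {B = B} f f∈llp =
  Level.lift (section⇒IsWeq (f∈llp letterHom letterHom∈rlp-𝓒∩W unit (toSaturate B) (λ _ → refl)))
  where open WordLifts f

mainTheorem18 : ∀ {A B} (f : Hom A B) →
    ((𝓒 ∩ W) f → llp (rlp (𝓒 ∩ W)) f) × (llp (rlp (𝓒 ∩ W)) f → (𝓒 ∩ W) f)
mainTheorem18 f = ⊆-llp-rlp f , λ f∈llp → llp-rlp-𝓒∩W⊆𝓒 f f∈llp , llp-rlp-𝓒∩W⊆W f f∈llp
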